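{- Let $f$ be a one-way function. Then there exist an integer function $r(\cdot)$ and a sequence of sets $\mathcal{S}=\{S_n\}$ with $S_n\subseteq\{0,1\}^n$ and $|S_n|\geq\frac{2^n}{n}$ such that $f$ is an $\mathcal{S}$-one-way function with regularity $r$.
   Context: A one-way function is a polynomial-time computable $f:\{0,1\}^*\to\{0,1\}^*$ such that for every probabilistic polynomial-time (PPT) $A$ there is a negligible $\mu$ with $\Pr[x\leftarrow\{0,1\}^n: A(1^n,f(x))\in f^{ -1}(f(x))]\leq\mu(n)$ for all $n$. For $\mathcal{S}=\{S_n\}$, $S_n\subseteq\{0,1\}^n$, $f$ is an $\mathcal{S}$-one-way function if it is polynomial-time computable and for every PPT $A$ there is a negligible $\mu$ with $\Pr[x\leftarrow S_n: A(1^n,f(x))\in f^{ -1}(f(x))]\leq\mu(n)$ for all $n$. It has regularity $r$ (over $\mathcal{S}$) if for all $n$ and all $x\in S_n$, $2^{r(n)-1}\leq|f^{ -1}(f(x))|\leq 2^{r(n)}$, where $f^{ -1}(f(x))$ denotes the set of preimages of $f(x)$ in $\{0,1\}^n$. -}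

module Defs where

open import Data.Bool using (Bool; true; false; if_then_else_)
open import Data.Nat using (ℕ; zero; suc; _+_; _*_; _^_; _≤_)
open import Data.List using (List; []; _∷_; _++_; map; length; filter; replicate; foldr)
open import Data.List.Properties using (≡-dec)
open import Data.Maybe using (Maybe; just; nothing)
open import Data.Fin using (Fin)
open import Data.Product using (Σ; ∃; _×_; _,_)
open import Data.Integer using (+_)
open import Data.Rational using (ℚ; 0ℚ; _/_) renaming (_+_ to _+ℚ_; _*_ to _*ℚ_; _≤_ to _≤ℚ_)
open import Relation.Binary.PropositionalEquality using (_≡_)
open import Relation.Nullary using (Dec; yes; no; does)
import Data.Bool.Properties as BoolP

Bits : Set
Bits = List Bool

allStrings : ℕ → List Bits
allStrings zero    = [] ∷ []
allStrings (suc n) = map (false ∷_) (allStrings n) ++ map (true ∷_) (allStrings n)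

_≟B_ : (x y : Bits) → Dec (x ≡ y)
_≟B_ = ≡-dec BoolP._≟_

countB : {A : Set} → (A → Bool) → List A → ℕ
countB P xs = length (filter (λ a → P a BoolP.≟ true) xs)

preimageCount : (Bits → Bits) → Bits → ℕ
preimageCount f x = countB (λ x' → does (f x' ≟B f x)) (allStrings (length x))

ratio : ℕ → ℕ → ℚ
ratio a zero    = 0ℚ
ratio a (suc b) = (+ a) / suc b

ℕtoℚ : ℕ → ℚ
ℕtoℚ a = (+ a) / 1

sumℚ : List ℚ → ℚ
sumℚ = foldr _+ℚ_ 0ℚ

data Sym : Set where
  blank bit0 bit1 sep : Sym

data Move : Set where
  left right stay : Move

-- states Fin (suc Q); start state is zero; the machine halts when δ is undefined
record TM : Set where
  field
    Q : ℕ
    δ : Fin (suc Q) → Sym → Maybe (Fin (suc Q) × Sym × Move)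

record Tape : Set where
  constructor tape
  field
    lft  : List Sym   -- reversed: nearest cell first
    hd   : Sym
    rgt  : List Sym

encB : Bool → Sym
encB false = bit0
encB true  = bit1

initTape : List Sym → Tape
initTape []       = tape [] blank []
initTape (s ∷ ss) = tape [] s ss

moveT : Move → Tape → Tape
moveT left  (tape []       h r) = tape [] blank (h ∷ r)
moveT left  (tape (l ∷ ls) h r) = tape ls l (h ∷ r)
moveT right (tape l h [])       = tape (h ∷ l) blank []
moveT right (tape l h (x ∷ r))  = tape (h ∷ l) x r
moveT stay  t                   = t

runTM : (M : TM) → ℕ → Fin (suc (TM.Q M)) → Tape → Maybe Tape
runTM M fuel q (tape l h r) with TM.δ M q h
... | nothing = just (tape l h r)
... | just (q' , s , m) with fuel
...   | zero    = nothing
...   | suc k   = runTM M k q' (moveT m (tape l s r))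

readBits : List Sym → Bits
readBits (bit0 ∷ ss) = false ∷ readBits ss
readBits (bit1 ∷ ss) = true ∷ readBits ss
readBits _           = []

outputT : Tape → Bits
outputT (tape _ h r) = readBits (h ∷ r)

execTM : TM → ℕ → List Sym → Maybe Bits
execTM M fuel w with runTM M fuel Fin.zero (initTape w)
... | nothing = nothing
... | just t  = just (outputT t)

poly : ℕ → ℕ → ℕ
poly c m = m ^ c + c

PolyTimeComputable : (Bits → Bits) → Set
PolyTimeComputable f =
  Σ TM λ M → Σ ℕ λ c → (x : Bits) →
    execTM M (poly c (length x)) (map encB x) ≡ just (f x)

-- On input
-- (1^n, y) it gets a uniformly random coin string of length T = (n+|y|)^c + c
-- (placed after the input) and is run for at most T steps.

record PPT : Set where
  constructor ppt
  field
    machine  : TM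
    exponent : ℕ

timeBound : PPT → ℕ → Bits → ℕ
timeBound A n y = poly (PPT.exponent A) (n + length y)

advInput : ℕ → Bits → Bits → List Sym
advInput n y coins = replicate n bit1 ++ sep ∷ map encB y ++ sep ∷ map encB coins

inverts : (Bits → Bits) → PPT → ℕ → Bits → Bits → Bool
inverts f A n y coins with execTM (PPT.machine A) (timeBound A n y) (advInput n y coins)
... | nothing = false
... | just x' = does (length x' Data.Nat.≟ n) Data.Bool.∧ does (f x' ≟B y)

successOn : (Bits → Bits) → PPT → ℕ → Bits → ℚ
successOn f A n x =
  ratio (countB (inverts f A n (f x)) (allStrings (timeBound A n (f x))))
        (2 ^ timeBound A n (f x))

-- Pr[x ← D ; A(1^n, f(x)) ∈ f⁻¹(f(x))] for D uniform on the finite list D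
-- (0 if D is empty)
successProb : (Bits → Bits) → PPT → ℕ → List Bits → ℚ
successProb f A n D = sumℚ (map (successOn f A n) D) *ℚ ratio 1 (length D)

Negligible : (ℕ → ℚ) → Set
Negligible μ = (c : ℕ) → Σ ℕ λ N → (n : ℕ) → N ≤ n → μ n *ℚ ℕtoℚ (n ^ c) ≤ℚ ℕtoℚ 1

SetSeq : Set
SetSeq = ℕ → Bits → Bool

elems : SetSeq → ℕ → List Bits
elems S n = filter (λ x → S n x BoolP.≟ true) (allStrings n)

OneWay : (Bits → Bits) → Set
OneWay f = PolyTimeComputable f ×
  ((A : PPT) → Σ (ℕ → ℚ) λ μ → Negligible μ ×
     ((n : ℕ) → successProb f A n (allStrings n) ≤ℚ μ n))

SOneWay : SetSeq → (Bits → Bits) → Set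
SOneWay S f = PolyTimeComputable f ×
  ((A : PPT) → Σ (ℕ → ℚ) λ μ → Negligible μ ×
     ((n : ℕ) → successProb f A n (elems S n) ≤ℚ μ n))

-- regularity r over S:  2^{r(n)-1} ≤ |f⁻¹(f(x))| ≤ 2^{r(n)}  for x ∈ S_n,
-- written over ℕ as 2^{r(n)} ≤ 2·|f⁻¹(f(x))| ≤ 2·2^{r(n)}
HasRegularity : SetSeq → (Bits → Bits) → (ℕ → ℕ) → Set
HasRegularity S f r = (n : ℕ) (x : Bits) → length x ≡ n → S n x ≡ true →
  (2 ^ r n ≤ 2 * preimageCount f x) × (preimageCount f x ≤ 2 ^ r n)

-- |S_n| ≥ 2^n / n   (for n ≥ 1), written as 2^n ≤ n·|S_n|
LargeSets : SetSeq → Set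
LargeSets S = (n : ℕ) → 1 ≤ n → 2 ^ n ≤ n * length (elems S n)

-- For 1 ≤ j ≤ n let C_j be the set of x ∈ {0,1}^n with 2^(j-1) ≤ |f⁻¹(f(x))| ≤ 2^j.
-- Since 1 ≤ |f⁻¹(f(x))| ≤ 2^n these n classes cover {0,1}^n, so the largest one, S_n = C_r(n),
-- has at least 2^n/n elements, and f has regularity r on it by construction. Sampling x from
-- S_n instead of {0,1}^n raises an inverter's success probability by at most the factor
-- 2^n/|S_n| ≤ n, and n times a negligible function is negligible.

module Submission where

open import Defs
open import Data.Bool using (Bool; true; false; _∨_)
open import Data.Bool.ListAction using (any)
import Data.Bool.Properties as Boolₚ
import Data.Integer as ℤ
import Data.Integer.Properties as ℤₚ
open import Data.List using (List; []; _∷_; _++_; map; length; filter; applyUpTo)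
open import Data.List.Extrema.Nat using (argmax; f[xs]≤f[argmax])
open import Data.List.Membership.Propositional using (_∈_; lose)
open import Data.List.Membership.Propositional.Properties
  using (∈-map⁺; ∈-map⁻; ∈-++⁺ˡ; ∈-++⁺ʳ; ∈-++⁻; ∈-applyUpTo⁺)
open import Data.List.Properties
  using (length-++; length-map; length-filter; filter-all; filter-some; length-applyUpTo)
open import Data.List.Relation.Unary.All as All using (All; []; _∷_)
open import Data.List.Relation.Unary.Any as Any using (Any; here)
open import Data.List.Relation.Unary.Any.Properties using (any⁺)
open import Data.Nat using (ℕ; zero; suc; _+_; _*_; _^_; _≤_; _<_; z≤n; s≤s; _≤?_)
import Data.Nat.Properties as ℕₚ
open import Data.Nat.ListAction using (sum)
open import Data.Product using (Σ; ∃-syntax; _×_; _,_)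
open import Data.Rational using (ℚ; 0ℚ; toℚᵘ; NonNegative; nonNegative)
  renaming (_*_ to _*ℚ_; _≤_ to _≤ℚ_)
import Data.Rational.Properties as ℚₚ
import Data.Rational.Unnormalised as ℚᵘ
import Data.Rational.Unnormalised.Properties as ℚᵘₚ
open import Data.Sum using (inj₁; inj₂)
open import Function using (Equivalence)
open import Algebra.Bundles using (CommutativeMonoid)
import Algebra.Properties.CommutativeSemigroup as CommutativeSemigroupProperties
open import Relation.Binary.PropositionalEquality
  using (_≡_; refl; sym; trans; cong; cong₂; subst; subst₂; module ≡-Reasoning)
open import Relation.Nullary using (Dec; yes; no; does)
open import Relation.Nullary.Decidable using (_×-dec_; dec-true)

countB≤length : {A : Set} (P : A → Bool) (xs : List A) → countB P xs ≤ length xs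
countB≤length P = length-filter (λ a → P a Boolₚ.≟ true)

countB-pos : {A : Set} (P : A → Bool) {x : A} {xs : List A} → x ∈ xs → P x ≡ true → 1 ≤ countB P xs
countB-pos P x∈xs Px = filter-some (λ a → P a Boolₚ.≟ true) (lose x∈xs Px)

countB-all : {A : Set} (P : A → Bool) (xs : List A) →
  (∀ {x} → x ∈ xs → P x ≡ true) → countB P xs ≡ length xs
countB-all P xs all = cong length (filter-all (λ a → P a Boolₚ.≟ true) (All.tabulate all))

countB-∨ : {A : Set} (P Q : A → Bool) (xs : List A) →
  countB (λ x → P x ∨ Q x) xs ≤ countB P xs + countB Q xs
countB-∨ P Q [] = z≤n
countB-∨ P Q (x ∷ xs) with P x | Q x
... | true  | true  = s≤s (ℕₚ.≤-trans (countB-∨ P Q xs) (ℕₚ.+-monoʳ-≤ _ (ℕₚ.n≤1+n _)))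
... | true  | false = s≤s (countB-∨ P Q xs)
... | false | true  = ℕₚ.≤-trans (s≤s (countB-∨ P Q xs)) (ℕₚ.≤-reflexive (sym (ℕₚ.+-suc _ _)))
... | false | false = countB-∨ P Q xs

countB-false : {A : Set} (xs : List A) → countB (λ _ → false) xs ≡ 0
countB-false []       = refl
countB-false (_ ∷ xs) = countB-false xs

countB-any≤sum : {A J : Set} (P : J → A → Bool) (js : List J) (xs : List A) →
  countB (λ x → any (λ j → P j x) js) xs ≤ sum (map (λ j → countB (P j) xs) js)
countB-any≤sum P []       xs = ℕₚ.≤-reflexive (countB-false xs)
countB-any≤sum P (j ∷ js) xs = ℕₚ.≤-trans (countB-∨ (P j) (λ x → any (λ j → P j x) js) xs)
  (ℕₚ.+-monoʳ-≤ (countB (P j) xs) (countB-any≤sum P js xs))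

sum-map≤length* : {J : Set} (g : J → ℕ) (M : ℕ) {js : List J} →
  All (λ j → g j ≤ M) js → sum (map g js) ≤ length js * M
sum-map≤length* g M []         = z≤n
sum-map≤length* g M (gj≤M ∷ h) = ℕₚ.+-mono-≤ gj≤M (sum-map≤length* g M h)

pigeonhole : {A J : Set} (P : J → A → Bool) (default : J) (js : List J) (xs : List A) →
  (∀ {x} → x ∈ xs → Any (λ j → P j x ≡ true) js) →
  length xs ≤ length js * countB (P (argmax (λ j → countB (P j) xs) default js)) xs
pigeonhole {J = J} P default js xs covered = begin
  length xs
    ≡⟨ sym (countB-all _ xs (λ x∈xs → Equivalence.to Boolₚ.T-≡
             (any⁺ _ (Any.map (Equivalence.from Boolₚ.T-≡) (covered x∈xs))))) ⟩
  countB (λ x → any (λ j → P j x) js) xs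
    ≤⟨ countB-any≤sum P js xs ⟩
  sum (map size js)
    ≤⟨ sum-map≤length* size (size best) (f[xs]≤f[argmax] default js) ⟩
  length js * size best ∎
  where
  open ℕₚ.≤-Reasoning
  size : J → ℕ
  size j = countB (P j) xs
  best : J
  best = argmax size default js

length-allStrings : ∀ n → length (allStrings n) ≡ 2 ^ n
length-allStrings zero    = refl
length-allStrings (suc n) = begin
  length (map (false ∷_) xs ++ map (true ∷_) xs)
    ≡⟨ length-++ (map (false ∷_) xs) ⟩
  length (map (false ∷_) xs) + length (map (true ∷_) xs)
    ≡⟨ cong₂ _+_ (length-map (false ∷_) xs) (length-map (true ∷_) xs) ⟩
  length xs + length xs
    ≡⟨ cong (λ m → m + m) (length-allStrings n) ⟩
  2 ^ n + 2 ^ n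
    ≡⟨ cong (2 ^ n +_) (sym (ℕₚ.+-identityʳ (2 ^ n))) ⟩
  2 ^ suc n ∎
  where
  open ≡-Reasoning
  xs : List Bits
  xs = allStrings n

∈-allStrings : (x : Bits) → x ∈ allStrings (length x)
∈-allStrings []          = here refl
∈-allStrings (false ∷ x) = ∈-++⁺ˡ (∈-map⁺ (false ∷_) (∈-allStrings x))
∈-allStrings (true ∷ x)  =
  ∈-++⁺ʳ (map (false ∷_) (allStrings (length x))) (∈-map⁺ (true ∷_) (∈-allStrings x))

∈-allStrings⁻ : ∀ {x} n → x ∈ allStrings n → length x ≡ n
∈-allStrings⁻ zero    (here refl) = refl
∈-allStrings⁻ (suc n) x∈ with ∈-++⁻ (map (false ∷_) (allStrings n)) x∈
... | inj₁ x∈₀ with _ , y∈ , refl ← ∈-map⁻ (false ∷_) x∈₀ = cong suc (∈-allStrings⁻ n y∈)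
... | inj₂ x∈₁ with _ , y∈ , refl ← ∈-map⁻ (true ∷_) x∈₁  = cong suc (∈-allStrings⁻ n y∈)

module _ (f : Bits → Bits) where

  preimageCount-pos : (x : Bits) → 1 ≤ preimageCount f x
  preimageCount-pos x = countB-pos _ (∈-allStrings x) (dec-true (f x ≟B f x) refl)

  preimageCount≤ : (x : Bits) → preimageCount f x ≤ 2 ^ length x
  preimageCount≤ x = ℕₚ.≤-trans (countB≤length _ (allStrings (length x)))
                                 (ℕₚ.≤-reflexive (length-allStrings (length x)))

DyadicBracket : ℕ → ℕ → Set
DyadicBracket j p = 2 ^ j ≤ 2 * p × p ≤ 2 ^ j

dyadicBracket? : ∀ j p → Dec (DyadicBracket j p)
dyadicBracket? j p = (2 ^ j ≤? 2 * p) ×-dec (p ≤? 2 ^ j)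

does-true⇒ : {P : Set} (p? : Dec P) → does p? ≡ true → P
does-true⇒ (yes p) _ = p

dyadicBracket-exists : ∀ m p → 1 ≤ p → p ≤ 2 ^ suc m → ∃[ i ] i < suc m × DyadicBracket (suc i) p
dyadicBracket-exists zero    p 1≤p p≤2 = 0 , s≤s z≤n , ℕₚ.*-monoʳ-≤ 2 1≤p , p≤2
dyadicBracket-exists (suc m) p 1≤p p≤2^2+m with p ≤? 2 ^ suc m
... | yes p≤2^1+m with i , i<1+m , bracket ← dyadicBracket-exists m p 1≤p p≤2^1+m
                  = i , ℕₚ.m<n⇒m<1+n i<1+m , bracket
... | no  p≰2^1+m = suc m , ℕₚ.≤-refl , ℕₚ.*-monoʳ-≤ 2 (ℕₚ.<⇒≤ (ℕₚ.≰⇒> p≰2^1+m)) , p≤2^2+m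

ratio-nonNeg : ∀ a b → 0ℚ ≤ℚ ratio a b
ratio-nonNeg a zero    = ℚₚ.≤-refl
ratio-nonNeg a (suc b) = ℚₚ.nonNegative⁻¹ _ {{ℚₚ.normalize-nonNeg a (suc b)}}

ℕtoℚ-nonNeg : ∀ a → NonNegative (ℕtoℚ a)
ℕtoℚ-nonNeg a = nonNegative (ratio-nonNeg a 1)

toℚᵘ-ratio : ∀ a b → toℚᵘ (ratio a (suc b)) ℚᵘ.≃ ℚᵘ.mkℚᵘ (ℤ.+ a) b
toℚᵘ-ratio a b = ℚₚ.toℚᵘ-fromℚᵘ (ℚᵘ.mkℚᵘ (ℤ.+ a) b)

ℕtoℚ-* : ∀ a b → ℕtoℚ (a * b) ≡ ℕtoℚ a *ℚ ℕtoℚ b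
ℕtoℚ-* a b = ℚₚ.toℚᵘ-injective (begin
  toℚᵘ (ℕtoℚ (a * b))                           ≈⟨ toℚᵘ-ratio (a * b) 0 ⟩
  ℚᵘ.mkℚᵘ (ℤ.+ (a * b)) 0                         ≈⟨ ℚᵘ.*≡* (cong (ℤ._* ℤ.+ 1) (ℤₚ.pos-* a b)) ⟩
  ℚᵘ.mkℚᵘ (ℤ.+ a) 0 ℚᵘ.* ℚᵘ.mkℚᵘ (ℤ.+ b) 0      ≈⟨ ℚᵘₚ.*-cong (toℚᵘ-ratio a 0) (toℚᵘ-ratio b 0) ⟨
  toℚᵘ (ℕtoℚ a) ℚᵘ.* toℚᵘ (ℕtoℚ b)                ≈⟨ ℚₚ.toℚᵘ-homo-* (ℕtoℚ a) (ℕtoℚ b) ⟨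
  toℚᵘ (ℕtoℚ a *ℚ ℕtoℚ b)                        ∎)
  where open ℚᵘₚ.≃-Reasoning

ratio1≤ℕtoℚ*ratio1 : ∀ {a b} k → 1 ≤ a → a ≤ k * b → ratio 1 b ≤ℚ ℕtoℚ k *ℚ ratio 1 a
ratio1≤ℕtoℚ*ratio1 {suc a} {zero}  k _ a≤k*0 with () ← ℕₚ.≤-trans a≤k*0 (ℕₚ.≤-reflexive (ℕₚ.*-zeroʳ k))
ratio1≤ℕtoℚ*ratio1 {suc a} {suc b} k _ a≤k*b = ℚₚ.toℚᵘ-cancel-≤ (begin
  toℚᵘ (ratio 1 (suc b))                      ≃⟨ toℚᵘ-ratio 1 b ⟩
  ℚᵘ.mkℚᵘ (ℤ.+ 1) b                           ≤⟨ ℚᵘ.*≤* (subst₂ ℤ._≤_ lhs rhs (ℤ.+≤+ a≤k*b)) ⟩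
  ℚᵘ.mkℚᵘ (ℤ.+ k) 0 ℚᵘ.* ℚᵘ.mkℚᵘ (ℤ.+ 1) a    ≃⟨ ℚᵘₚ.*-cong (toℚᵘ-ratio k 0) (toℚᵘ-ratio 1 a) ⟨
  toℚᵘ (ℕtoℚ k) ℚᵘ.* toℚᵘ (ratio 1 (suc a))   ≃⟨ ℚₚ.toℚᵘ-homo-* (ℕtoℚ k) (ratio 1 (suc a)) ⟨
  toℚᵘ (ℕtoℚ k *ℚ ratio 1 (suc a))            ∎)
  where
  open ℚᵘₚ.≤-Reasoning
  lhs : ℤ.+ suc a ≡ ℤ.+ 1 ℤ.* ℤ.+ suc (a + 0)
  lhs = trans (cong (λ m → ℤ.+ suc m) (sym (ℕₚ.+-identityʳ a))) (sym (ℤₚ.*-identityˡ _))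
  rhs : ℤ.+ (k * suc b) ≡ (ℤ.+ k ℤ.* ℤ.+ 1) ℤ.* ℤ.+ suc b
  rhs = trans (ℤₚ.pos-* k (suc b)) (cong (ℤ._* ℤ.+ suc b) (sym (ℤₚ.*-identityʳ (ℤ.+ k))))

private
  module ℚ* = CommutativeSemigroupProperties
                (CommutativeMonoid.commutativeSemigroup ℚₚ.*-1-commutativeMonoid)

sumℚ-nonNeg : {A : Set} (s : A → ℚ) → (∀ x → 0ℚ ≤ℚ s x) → (xs : List A) → 0ℚ ≤ℚ sumℚ (map s xs)
sumℚ-nonNeg s s≥0 []       = ℚₚ.≤-refl
sumℚ-nonNeg s s≥0 (x ∷ xs) = ℚₚ.+-mono-≤ (s≥0 x) (sumℚ-nonNeg s s≥0 xs)

sumℚ-filter≤ : {A : Set} (s : A → ℚ) → (∀ x → 0ℚ ≤ℚ s x) → (P : A → Bool) (xs : List A) →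
  sumℚ (map s (filter (λ a → P a Boolₚ.≟ true) xs)) ≤ℚ sumℚ (map s xs)
sumℚ-filter≤ s s≥0 P []       = ℚₚ.≤-refl
sumℚ-filter≤ s s≥0 P (x ∷ xs) with P x
... | true  = ℚₚ.+-monoʳ-≤ (s x) (sumℚ-filter≤ s s≥0 P xs)
... | false = ℚₚ.≤-trans (ℚₚ.≤-reflexive (sym (ℚₚ.+-identityˡ _)))
                        (ℚₚ.+-mono-≤ (s≥0 x) (sumℚ-filter≤ s s≥0 P xs))

-- successProb f A n D is definitionally mean (successOn f A n) D.
mean : {A : Set} → (A → ℚ) → List A → ℚ
mean s xs = sumℚ (map s xs) *ℚ ratio 1 (length xs)

mean-filter≤ : {A : Set} (s : A → ℚ) → (∀ x → 0ℚ ≤ℚ s x) → (P : A → Bool) (xs : List A) (k : ℕ) →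
  1 ≤ length xs → length xs ≤ k * countB P xs →
  mean s (filter (λ a → P a Boolₚ.≟ true) xs) ≤ℚ ℕtoℚ k *ℚ mean s xs
mean-filter≤ s s≥0 P xs k xs≢[] xs≤k*|P| = begin
  sumℚ (map s (filter _ xs)) *ℚ ratio 1 (countB P xs)
    ≤⟨ ℚₚ.*-monoʳ-≤-nonNeg (ratio 1 (countB P xs)) {{nonNegative (ratio-nonNeg 1 (countB P xs))}}
         (sumℚ-filter≤ s s≥0 P xs) ⟩
  total *ℚ ratio 1 (countB P xs)
    ≤⟨ ℚₚ.*-monoˡ-≤-nonNeg total {{nonNegative (sumℚ-nonNeg s s≥0 xs)}}
         (ratio1≤ℕtoℚ*ratio1 k xs≢[] xs≤k*|P|) ⟩
  total *ℚ (ℕtoℚ k *ℚ ratio 1 (length xs))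
    ≡⟨ ℚ*.x∙yz≈y∙xz total (ℕtoℚ k) (ratio 1 (length xs)) ⟩
  ℕtoℚ k *ℚ (total *ℚ ratio 1 (length xs)) ∎
  where
  open ℚₚ.≤-Reasoning
  total : ℚ
  total = sumℚ (map s xs)

nℚ*q*n^c≡q*n^1+c : ∀ n c (q : ℚ) → (ℕtoℚ n *ℚ q) *ℚ ℕtoℚ (n ^ c) ≡ q *ℚ ℕtoℚ (n ^ suc c)
nℚ*q*n^c≡q*n^1+c n c q = begin
  (ℕtoℚ n *ℚ q) *ℚ ℕtoℚ (n ^ c) ≡⟨ ℚ*.xy∙z≈y∙xz (ℕtoℚ n) q (ℕtoℚ (n ^ c)) ⟩
  q *ℚ (ℕtoℚ n *ℚ ℕtoℚ (n ^ c)) ≡⟨ cong (q *ℚ_) (ℕtoℚ-* n (n ^ c)) ⟨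
  q *ℚ ℕtoℚ (n ^ suc c)         ∎
  where open ≡-Reasoning

negligible-≤n* : {μ ν : ℕ → ℚ} → Negligible μ → (∀ n → 1 ≤ n → ν n ≤ℚ ℕtoℚ n *ℚ μ n) → Negligible ν
negligible-≤n* {μ} {ν} negl ν≤n*μ c with N , μ-small ← negl (suc c) = suc N , ν-small
  where
  ν-small : ∀ n → suc N ≤ n → ν n *ℚ ℕtoℚ (n ^ c) ≤ℚ ℕtoℚ 1
  ν-small n@(suc m) (s≤s N≤m) = begin
    ν n *ℚ ℕtoℚ (n ^ c)
      ≤⟨ ℚₚ.*-monoʳ-≤-nonNeg (ℕtoℚ (n ^ c)) {{ℕtoℚ-nonNeg (n ^ c)}} (ν≤n*μ n (s≤s z≤n)) ⟩
    (ℕtoℚ n *ℚ μ n) *ℚ ℕtoℚ (n ^ c) ≡⟨ nℚ*q*n^c≡q*n^1+c n c (μ n) ⟩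
    μ n *ℚ ℕtoℚ (n ^ suc c)         ≤⟨ μ-small n (ℕₚ.m≤n⇒m≤1+n N≤m) ⟩
    ℕtoℚ 1                          ∎
    where open ℚₚ.≤-Reasoning

module RegularPart (f : Bits → Bits) where

  inClass : ℕ → Bits → Bool
  inClass j x = does (dyadicBracket? j (preimageCount f x))

  exponents : ℕ → List ℕ
  exponents n = applyUpTo suc n

  regularity : ℕ → ℕ
  regularity n = argmax (λ j → countB (inClass j) (allStrings n)) 1 (exponents n)

  S : SetSeq
  S n = inClass (regularity n)

  covered : ∀ m {x} → x ∈ allStrings (suc m) → Any (λ j → inClass j x ≡ true) (exponents (suc m))
  covered m {x} x∈ = inBracketClass (dyadicBracket-exists m p (preimageCount-pos f x) p≤2^1+m)
    where
    p : ℕ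
    p = preimageCount f x
    p≤2^1+m : p ≤ 2 ^ suc m
    p≤2^1+m = subst (λ n → p ≤ 2 ^ n) (∈-allStrings⁻ (suc m) x∈) (preimageCount≤ f x)
    inBracketClass : ∃[ i ] i < suc m × DyadicBracket (suc i) p →
                     Any (λ j → inClass j x ≡ true) (exponents (suc m))
    inBracketClass (i , i<1+m , bracket) =
      lose (∈-applyUpTo⁺ suc i<1+m) (dec-true (dyadicBracket? (suc i) p) bracket)

  large : LargeSets S
  large n@(suc m) _ = begin
    2 ^ n                                      ≡⟨ length-allStrings n ⟨
    length (allStrings n)                      ≤⟨ pigeonhole inClass 1 (exponents n) (allStrings n) (covered m) ⟩
    length (exponents n) * length (elems S n)  ≡⟨ cong (_* length (elems S n)) (length-applyUpTo suc n) ⟩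
    n * length (elems S n)                     ∎
    where open ℕₚ.≤-Reasoning

  regular : HasRegularity S f regularity
  regular n x _ x∈S = does-true⇒ (dyadicBracket? (regularity n) (preimageCount f x)) x∈S

  successProb-S≤ : ∀ A n → 1 ≤ n →
    successProb f A n (elems S n) ≤ℚ ℕtoℚ n *ℚ successProb f A n (allStrings n)
  successProb-S≤ A n 1≤n = mean-filter≤ (successOn f A n) successOn-nonNeg (S n) (allStrings n) n
    (subst (1 ≤_) (sym (length-allStrings n)) (ℕₚ.m^n>0 2 n))
    (subst (_≤ n * length (elems S n)) (sym (length-allStrings n)) (large n 1≤n))
    where
    successOn-nonNeg : ∀ x → 0ℚ ≤ℚ successOn f A n x
    successOn-nonNeg x = ratio-nonNeg _ (2 ^ timeBound A n (f x))

  sOneWay : OneWay f → SOneWay S f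
  sOneWay (computable , hard) = computable , λ A → let μ , negl , success≤μ = hard A in
      (λ n → successProb f A n (elems S n))
    , negligible-≤n* negl (λ n 1≤n → ℚₚ.≤-trans (successProb-S≤ A n 1≤n)
        (ℚₚ.*-monoˡ-≤-nonNeg (ℕtoℚ n) {{ℕtoℚ-nonNeg n}} (success≤μ n)))
    , λ _ → ℚₚ.≤-refl

lemma5p6 : (f : Bits → Bits) → OneWay f →
    Σ (ℕ → ℕ) λ r → Σ SetSeq λ S →
    LargeSets S × SOneWay S f × HasRegularity S f r
lemma5p6 f ow = regularity , S , large , sOneWay ow , regular
  where open RegularPart f
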